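{- Let $D\ge 1$ and let $\mathcal{M}\subseteq \{x_0,x_1\}^D$ be a nonempty finite set of degree-$D$ monomials (words of length $D$) over the two noncommuting variables $x_0,x_1$. Then $\mathcal{M}$ has an isolating index set of size at most $\log_2 |\mathcal{M}|$.
   Context: For a word $m\in\{x_0,x_1\}^D$ and $i\in[D]=\{1,\ldots,D\}$, $m[i]$ denotes the variable in the $i$-th position of $m$ (positions indexed left to right). A subset $I\subseteq[D]$ is an isolating index set for $\mathcal{M}$ if there is a monomial $m\in\mathcal{M}$ such that for every $m'\in\mathcal{M}$ with $m'\neq m$ there is some $i\in I$ with $m[i]\neq m'[i]$. -}

module Defs where

open import Data.Bool using (Bool)
open import Data.Nat using (ℕ)
open import Data.Fin using (Fin)
open import Data.Fin.Subset using (Subset; _∈_)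
open import Data.Vec using (Vec; lookup)
open import Data.List using (List)
open import Data.List.Membership.Propositional renaming (_∈_ to _∈ₗ_)
open import Data.Product using (Σ; ∃-syntax; _×_)
open import Relation.Binary.PropositionalEquality using (_≡_)
open import Relation.Nullary using (¬_)

-- The two noncommuting variables: x₀ = false, x₁ = true.
Var : Set
Var = Bool

-- A degree-D monomial: a word of length D; position i (0-based Fin D,
-- i.e. position i+1 in the paper's 1-based [D]) holds m[i].
Word : ℕ → Set
Word D = Vec Var D

IsIsolating : {D : ℕ} → List (Word D) → Subset D → Set
IsIsolating {D} M I =
  ∃[ m ] (m ∈ₗ M × (∀ m' → m' ∈ₗ M → ¬ (m' ≡ m) →
            ∃[ i ] (i ∈ I × ¬ (lookup m i ≡ lookup m' i))))

-- Split M by the first letter into the two sets of tails.  If one side is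
-- empty, the first position separates nothing and we recurse on the other
-- side.  Otherwise recurse on the smaller side, of size at most |M|/2 and
-- hence with an isolating set of size at most log₂|M| − 1, and add the
-- first position, which separates the isolated word from the whole other side.
module Submission where

open import Defs
import Data.Nat as ℕ
open import Data.Nat using (ℕ; ≢-nonZero; zero; suc; _+_; _*_; _≤_; _<_; _≥_; z≤n; s≤s; NonZero)
open import Data.Nat.Properties using (+-suc; +-identityʳ; +-monoʳ-≤; ≤-total; ≤-trans; ≤-reflexive; module ≤-Reasoning)
open import Data.Nat.Logarithm using (⌊log₂_⌋; ⌊log₂⌋-mono-≤; ⌊log₂[2*b]⌋≡1+⌊log₂b⌋)
open import Data.Bool using (Bool; true; false; not)
open import Data.Bool.Properties using (_≟_; ¬-not)
open import Data.Fin using () renaming (zero to fzero; suc to fsuc)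
open import Data.Fin.Subset using (Subset; ∣_∣; _∈_; inside; outside)
open import Data.Vec using ([]; _∷_; lookup; here; there)
open import Data.List using (List; []; _∷_; length)
open import Data.List.Membership.Propositional renaming (_∈_ to _∈ₗ_)
open import Data.List.Relation.Unary.Any using (here; there)
open import Data.List.Relation.Unary.Unique.Propositional using (Unique)
open import Data.Product using (∃-syntax; _×_; _,_)
open import Function using (_∘_; case_of_)
open import Data.Sum using (inj₁; inj₂)
open import Relation.Binary.PropositionalEquality
open import Relation.Nullary using (yes; no; contradiction)

length≡0⇒≡[] : ∀ {A : Set} {xs : List A} → length xs ≡ 0 → xs ≡ []
length≡0⇒≡[] {xs = []} _ = refl

branch : ∀ {D} → Bool → List (Word (suc D)) → List (Word D)
branch b [] = []
branch b ((c ∷ xs) ∷ M) with b ≟ c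
... | yes _ = xs ∷ branch b M
... | no _ = branch b M

length-branch : ∀ {D} b (M : List (Word (suc D))) →
  length (branch (not b) M) + length (branch b M) ≡ length M
length-branch b [] = refl
length-branch false ((false ∷ _) ∷ M) = trans (+-suc _ _) (cong suc (length-branch false M))
length-branch false ((true ∷ _) ∷ M) = cong suc (length-branch false M)
length-branch true ((false ∷ _) ∷ M) = cong suc (length-branch true M)
length-branch true ((true ∷ _) ∷ M) = trans (+-suc _ _) (cong suc (length-branch true M))

length-branch≡length : ∀ {D} b (M : List (Word (suc D))) → branch (not b) M ≡ [] →
  length (branch b M) ≡ length M
length-branch≡length b M other≡[] =
  trans (cong (λ L → length L + length (branch b M)) (sym other≡[])) (length-branch b M)

∈-branch⁻ : ∀ {D} b (M : List (Word (suc D))) {xs} → xs ∈ₗ branch b M → b ∷ xs ∈ₗ M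
∈-branch⁻ b ((c ∷ ys) ∷ M) xs∈ with b ≟ c | xs∈
... | yes refl | here refl = here refl
... | yes _    | there xs∈′ = there (∈-branch⁻ b M xs∈′)
... | no _     | xs∈′ = there (∈-branch⁻ b M xs∈′)

∈-branch⁺ : ∀ {D} b (M : List (Word (suc D))) {xs} → b ∷ xs ∈ₗ M → xs ∈ₗ branch b M
∈-branch⁺ b ((c ∷ ys) ∷ M) bxs∈ with b ≟ c | bxs∈
... | yes _  | here refl = here refl
... | no b≢c | here refl = contradiction refl b≢c
... | yes _  | there bxs∈′ = there (∈-branch⁺ b M bxs∈′)
... | no _   | there bxs∈′ = ∈-branch⁺ b M bxs∈′

larger-branch : ∀ {D} (M : List (Word (suc D))) →
  ∃[ b ] length (branch (not b) M) ≤ length (branch b M)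
larger-branch M with ≤-total (length (branch true M)) (length (branch false M))
... | inj₁ t≤f = false , t≤f
... | inj₂ f≤t = true , f≤t

isolating-∷ : ∀ {D} b h (M : List (Word (suc D))) {I : Subset D} →
  (h ≡ outside → branch (not b) M ≡ []) →
  IsIsolating (branch b M) I → IsIsolating M (h ∷ I)
isolating-∷ b h M {I} other-side-empty (m , m∈ , isolates) =
  b ∷ m , ∈-branch⁻ b M m∈ , separate
  where
  first-inside : ∀ {c xs} → c ∷ xs ∈ₗ M → c ≢ b → h ≡ inside
  first-inside {c} {xs} cxs∈ c≢b = ¬-not λ h≡outside →
    case subst (xs ∈ₗ_) (other-side-empty h≡outside)
                 (subst (λ c → xs ∈ₗ branch c M) (¬-not c≢b) (∈-branch⁺ c M cxs∈)) of λ ()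

  separate : ∀ m′ → m′ ∈ₗ M → m′ ≢ b ∷ m →
    ∃[ i ] (i ∈ h ∷ I × lookup (b ∷ m) i ≢ lookup m′ i)
  separate (c ∷ xs) cxs∈ m′≢ with c ≟ b
  ... | no c≢b = fzero , subst (λ h → fzero ∈ h ∷ I) (sym (first-inside cxs∈ c≢b)) here , c≢b ∘ sym
  ... | yes refl with isolates xs (∈-branch⁺ c M cxs∈) (m′≢ ∘ cong (c ∷_))
  ...   | i , i∈I , differs = fsuc i , there i∈I , differs

⌊log₂⌋<⌊log₂⌋-of-double≤ : ∀ {a n} .{{_ : NonZero a}} → a + a ≤ n → ⌊log₂ a ⌋ < ⌊log₂ n ⌋
⌊log₂⌋<⌊log₂⌋-of-double≤ {a} {n} a+a≤n = begin
  suc ⌊log₂ a ⌋   ≡⟨ ⌊log₂[2*b]⌋≡1+⌊log₂b⌋ a ⟨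
  ⌊log₂ (2 * a) ⌋ ≤⟨ ⌊log₂⌋-mono-≤ (≤-trans (≤-reflexive (cong (a +_) (+-identityʳ a))) a+a≤n) ⟩
  ⌊log₂ n ⌋       ∎
  where open ≤-Reasoning

SmallIsolating : ∀ {D} → List (Word D) → Set
SmallIsolating M = ∃[ I ] (IsIsolating M I × ∣ I ∣ ≤ ⌊log₂ length M ⌋)

skip-first : ∀ {D} b (M : List (Word (suc D))) → branch (not b) M ≡ [] →
  SmallIsolating (branch b M) → SmallIsolating M
skip-first b M other≡[] (I , isolating , bound) =
  outside ∷ I , isolating-∷ b outside M (λ _ → other≡[]) isolating ,
  subst (λ n → ∣ I ∣ ≤ ⌊log₂ n ⌋) (length-branch≡length b M other≡[]) bound

use-first : ∀ {D} b (M : List (Word (suc D))) .{{_ : NonZero (length (branch b M))}} →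
  length (branch b M) + length (branch b M) ≤ length M →
  SmallIsolating (branch b M) → SmallIsolating M
use-first b M half (I , isolating , bound) =
  inside ∷ I , isolating-∷ b inside M (λ ()) isolating ,
  ≤-trans (s≤s bound) (⌊log₂⌋<⌊log₂⌋-of-double≤ half)

small-isolating : ∀ D (M : List (Word D)) → M ≢ [] → SmallIsolating M
small-isolating zero [] M≢[] = contradiction refl M≢[]
small-isolating zero M@([] ∷ _) _ =
  [] , ([] , here refl , λ { [] _ []≢[] → contradiction refl []≢[] }) , z≤n
small-isolating (suc D) M M≢[] with larger-branch M
... | b , small≤large with length (branch (not b) M) ℕ.≟ 0
...   | yes small≡0 = skip-first b M small≡[] (small-isolating D (branch b M) large≢[])
  where
  small≡[] : branch (not b) M ≡ []
  small≡[] = length≡0⇒≡[] small≡0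
  large≢[] : branch b M ≢ []
  large≢[] = M≢[] ∘ length≡0⇒≡[] ∘ trans (sym (length-branch≡length b M small≡[])) ∘ cong length
...   | no small≢0 = use-first (not b) M {{≢-nonZero small≢0}}
          (≤-trans (+-monoʳ-≤ _ small≤large) (≤-reflexive (length-branch b M)))
          (small-isolating D (branch (not b) M) (small≢0 ∘ cong length))

lemma1 : (D : ℕ) → D ≥ 1 → (M : List (Word D)) → Unique M → M ≢ [] →
    ∃[ I ] (IsIsolating M I × ∣ I ∣ ≤ ⌊log₂ length M ⌋)
lemma1 D _ M _ = small-isolating D M
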